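{- Let $G$ be a cluster graph and $k,\eta$ non-negative integers, and suppose $F\subseteq\binom{V(G)}{2}\setminus E(G)$ satisfies $|F|\le k$ and $G+F$ is an $\eta$-balanced cluster graph. Let $\mathcal{H}$ be the set of connected components of $G$ that $F$ modifies. Then (1) $|V(H)|\le k$ for every $H\in\mathcal{H}$, and (2) $\sum_{H\in\mathcal{H}}|V(H)|\le 2k$.
   Context: A cluster graph is a graph in which every connected component is a clique; a graph is $\eta$-balanced if any two of its connected components differ in number of vertices by at most $\eta$. $G+F=(V(G),E(G)\cup F)$. $F$ modifies a vertex $v$ if $v$ is an endpoint of some pair in $F$, and $F$ modifies a connected component $H$ of $G$ if it modifies at least one vertex of $H$. -}

module Defs where

open import Level using (0ℓ)
open import Data.Nat using (ℕ; _≤_; _+_; _*_)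
open import Data.Fin using (Fin; toℕ)
open import Data.Fin.Subset using (Subset; _∈_; ∣_∣)
open import Data.Product using (Σ; ∃; ∃-syntax; _×_; _,_; proj₁; proj₂)
open import Data.Sum using (_⊎_; inj₁; inj₂)
import Relation.Binary.PropositionalEquality as ≡
open import Data.List using (List; length; map)
open import Data.List.Relation.Unary.All using (All)
open import Data.List.Relation.Unary.Unique.Propositional using (Unique)
import Data.List.Membership.Propositional as LM
open import Relation.Nullary using (¬_)
open import Relation.Binary.PropositionalEquality using (_≡_; _≢_)
open import Relation.Binary.Construct.Closure.ReflexiveTransitive using (Star)
open import Function.Bundles using (_⇔_)
import Data.Nat as N

record Graph (n : ℕ) : Set₁ where
  field
    Adj   : Fin n → Fin n → Set
    sym   : ∀ {x y} → Adj x y → Adj y x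
    irrefl : ∀ {x} → ¬ Adj x x
open Graph public

Connected : ∀ {n} → Graph n → Fin n → Fin n → Set
Connected G = Star (Adj G)

IsComponent : ∀ {n} → Graph n → Subset n → Set
IsComponent G S =
  (∃[ x ] x ∈ S) × (∀ x y → x ∈ S → (y ∈ S ⇔ Connected G x y))

IsClique : ∀ {n} → Graph n → Subset n → Set
IsClique G S = ∀ x y → x ∈ S → y ∈ S → x ≢ y → Adj G x y

IsClusterGraph : ∀ {n} → Graph n → Set
IsClusterGraph G = ∀ S → IsComponent G S → IsClique G S

IsBalanced : ∀ {n} → ℕ → Graph n → Set
IsBalanced η G = ∀ S T → IsComponent G S → IsComponent G T → ∣ S ∣ ≤ ∣ T ∣ + η

-- A set F of unordered pairs of vertices is represented as a duplicate-free list
-- of ordered pairs (u , v) with toℕ u < toℕ v (canonical representative).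
PairSet : ℕ → Set
PairSet n = List (Fin n × Fin n)

ValidPairSet : ∀ {n} → PairSet n → Set
ValidPairSet F = All (λ p → toℕ (proj₁ p) N.< toℕ (proj₂ p)) F × Unique F

NonEdges : ∀ {n} → Graph n → PairSet n → Set
NonEdges G F = All (λ p → ¬ Adj G (proj₁ p) (proj₂ p)) F

-- G + F.  (The guard x ≢ y is vacuous for valid F, whose pairs have distinct
-- endpoints; it only makes G + F a simple graph by construction.)
_+E_ : ∀ {n} → Graph n → PairSet n → Graph n
G +E F = record
  { Adj = λ x y → Adj G x y ⊎ (x ≢ y × ((x , y) LM.∈ F ⊎ (y , x) LM.∈ F))
  ; sym = λ { (inj₁ a) → inj₁ (sym G a)
            ; (inj₂ (ne , inj₁ m)) → inj₂ ((λ e → ne (≡.sym e)) , inj₂ m)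
            ; (inj₂ (ne , inj₂ m)) → inj₂ ((λ e → ne (≡.sym e)) , inj₁ m) }
  ; irrefl = λ { (inj₁ a) → irrefl G a
               ; (inj₂ (ne , _)) → ne ≡.refl }
  }

ModifiesVertex : ∀ {n} → PairSet n → Fin n → Set
ModifiesVertex F v = ∃[ p ] (p LM.∈ F × (proj₁ p ≡ v ⊎ proj₂ p ≡ v))

ModifiesComponent : ∀ {n} → PairSet n → Subset n → Set
ModifiesComponent F S = ∃[ v ] (v ∈ S × ModifiesVertex F v)

{-# OPTIONS --safe #-}
-- If F modifies a component H of G, some pair {v₀, w} of F leaves H.  In the cluster graph G + F
-- every vertex of H is connected, hence adjacent, to w, and that edge cannot come from G since
-- w ∉ H; so H lies among the F-neighbours of w and |H| ≤ |F| ≤ k.  Distinct modified components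
-- are disjoint and consist of endpoints of F, so together they have at most 2|F| ≤ 2k vertices.
module Submission where

open import Defs
open import Level using (0ℓ)
open import Data.Nat using (ℕ; suc; _+_; _*_; _≤_)
open import Data.Nat.Properties
  using (+-suc; +-identityʳ; m≤m+n; +-mono-≤; ≤-trans; ≤-reflexive; *-comm; *-identityʳ; *-monoʳ-≤; module ≤-Reasoning)
open import Data.Nat.ListAction using (sum)
open import Data.Bool using (if_then_else_)
open import Data.Bool.Properties using (T-≡)
open import Data.Fin using (Fin; _≟_)
open import Data.Fin.Properties using (<-irrefl; sequence)
open import Data.Fin.Subset using (Subset; inside; outside; _∈_; _∉_; _⊆_; _∪_; _∩_; ⁅_⁆; ⋃; ∣_∣; Empty)
open import Data.Fin.Subset.Properties
  using (∉⊥; Empty-unique; ∣⊥∣≡0; ∣⁅x⁆∣≡1; x∈⁅x⁆; x∈p∪q⁺; x∈p∪q⁻; x∈p∩q⁺; x∈p∩q⁻; ⊆-antisym; p⊆q⇒∣p∣≤∣q∣)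
open import Data.Vec using ([]; _∷_; tabulate)
open import Data.Vec.Properties using ([]=⇒lookup; lookup⇒[]=; lookup∘tabulate)
open import Data.Product using (_×_; ∃-syntax; _,_; proj₁)
open import Data.Product.Properties using (≡-dec)
open import Data.Sum using (_⊎_; inj₁; inj₂; [_,_]′)
open import Data.List using (List; []; _∷_; length; map)
open import Data.List.Relation.Unary.Any using (Any; here; there)
import Data.List.Relation.Unary.Any as Any
open import Data.List.Relation.Unary.Any.Properties using (map⁺)
open import Data.List.Relation.Unary.All using (All)
import Data.List.Relation.Unary.All as All
open import Data.List.Relation.Unary.AllPairs using (AllPairs; []; _∷_)
open import Data.List.Relation.Unary.Unique.Propositional using (Unique)
import Data.List.Membership.Propositional as List
import Data.List.Membership.DecPropositional as DecMembership
open import Effect.Monad using (RawMonad)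
open import Function.Base using (_∘_)
open import Function.Bundles using (Equivalence; mk⇔)
open import Relation.Binary.PropositionalEquality using (_≡_; _≢_; refl; trans; cong; cong₂; subst)
import Relation.Binary.PropositionalEquality as ≡
open import Relation.Binary.Construct.Closure.ReflexiveTransitive using (ε; _◅_; _◅◅_)
import Relation.Binary.Construct.Closure.ReflexiveTransitive as Star
open import Relation.Nullary using (¬_; Dec; yes; no; does; contradiction)
open import Relation.Nullary.Decidable
  using (isYes; _⊎-dec_; decidable-stable; ¬¬-excluded-middle; toWitness; fromWitness)
open import Relation.Nullary.Negation using (¬¬-Monad)
open import Relation.Unary using (Pred; Decidable)

open Equivalence using (to; from)

private
  variable
    n : ℕ
    x y : Fin n

∣p∪q∣+∣p∩q∣≡∣p∣+∣q∣ : (p q : Subset n) → ∣ p ∪ q ∣ + ∣ p ∩ q ∣ ≡ ∣ p ∣ + ∣ q ∣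
∣p∪q∣+∣p∩q∣≡∣p∣+∣q∣ []            []            = refl
∣p∪q∣+∣p∩q∣≡∣p∣+∣q∣ (inside  ∷ p) (inside  ∷ q) = cong suc (begin
  ∣ p ∪ q ∣ + suc ∣ p ∩ q ∣   ≡⟨ +-suc ∣ p ∪ q ∣ ∣ p ∩ q ∣ ⟩
  suc (∣ p ∪ q ∣ + ∣ p ∩ q ∣) ≡⟨ cong suc (∣p∪q∣+∣p∩q∣≡∣p∣+∣q∣ p q) ⟩
  suc (∣ p ∣ + ∣ q ∣)         ≡⟨ +-suc ∣ p ∣ ∣ q ∣ ⟨
  ∣ p ∣ + suc ∣ q ∣           ∎)
  where open ≡.≡-Reasoning
∣p∪q∣+∣p∩q∣≡∣p∣+∣q∣ (inside  ∷ p) (outside ∷ q) = cong suc (∣p∪q∣+∣p∩q∣≡∣p∣+∣q∣ p q)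
∣p∪q∣+∣p∩q∣≡∣p∣+∣q∣ (outside ∷ p) (inside  ∷ q) =
  trans (cong suc (∣p∪q∣+∣p∩q∣≡∣p∣+∣q∣ p q)) (≡.sym (+-suc ∣ p ∣ ∣ q ∣))
∣p∪q∣+∣p∩q∣≡∣p∣+∣q∣ (outside ∷ p) (outside ∷ q) = ∣p∪q∣+∣p∩q∣≡∣p∣+∣q∣ p q

∣p∪q∣≤∣p∣+∣q∣ : (p q : Subset n) → ∣ p ∪ q ∣ ≤ ∣ p ∣ + ∣ q ∣
∣p∪q∣≤∣p∣+∣q∣ p q = ≤-trans (m≤m+n _ ∣ p ∩ q ∣) (≤-reflexive (∣p∪q∣+∣p∩q∣≡∣p∣+∣q∣ p q))

Disjoint : Subset n → Subset n → Set
Disjoint p q = Empty (p ∩ q)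

Disjoint⇒∣p∪q∣≡∣p∣+∣q∣ : (p q : Subset n) → Disjoint p q → ∣ p ∪ q ∣ ≡ ∣ p ∣ + ∣ q ∣
Disjoint⇒∣p∪q∣≡∣p∣+∣q∣ {n} p q p∩q-empty = begin
  ∣ p ∪ q ∣             ≡⟨ ≡.sym (+-identityʳ _) ⟩
  ∣ p ∪ q ∣ + 0         ≡⟨ cong (∣ p ∪ q ∣ +_) (≡.sym ∣p∩q∣≡0) ⟩
  ∣ p ∪ q ∣ + ∣ p ∩ q ∣ ≡⟨ ∣p∪q∣+∣p∩q∣≡∣p∣+∣q∣ p q ⟩
  ∣ p ∣ + ∣ q ∣         ∎
  where
  open ≡.≡-Reasoning
  ∣p∩q∣≡0 : ∣ p ∩ q ∣ ≡ 0
  ∣p∩q∣≡0 = trans (cong ∣_∣ (Empty-unique p∩q-empty)) (∣⊥∣≡0 n)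

x∈⋃⁺ : {ps : List (Subset n)} → Any (x ∈_) ps → x ∈ ⋃ ps
x∈⋃⁺ (here x∈p)    = x∈p∪q⁺ (inj₁ x∈p)
x∈⋃⁺ (there x∈ps) = x∈p∪q⁺ (inj₂ (x∈⋃⁺ x∈ps))

x∈⋃⁻ : (ps : List (Subset n)) → x ∈ ⋃ ps → Any (x ∈_) ps
x∈⋃⁻ []       x∈⊥   = contradiction x∈⊥ ∉⊥
x∈⋃⁻ (p ∷ ps) x∈p∪ = [ here , there ∘ x∈⋃⁻ ps ]′ (x∈p∪q⁻ p (⋃ ps) x∈p∪)

∣⋃map∣≤length* : {A : Set} (f : A → Subset n) {c : ℕ} → (∀ a → ∣ f a ∣ ≤ c) →
                 (xs : List A) → ∣ ⋃ (map f xs) ∣ ≤ length xs * c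
∣⋃map∣≤length* {n} f ∣f∣≤c []       = ≤-reflexive (∣⊥∣≡0 n)
∣⋃map∣≤length* {n} f ∣f∣≤c (a ∷ xs) =
  ≤-trans (∣p∪q∣≤∣p∣+∣q∣ (f a) _) (+-mono-≤ (∣f∣≤c a) (∣⋃map∣≤length* f ∣f∣≤c xs))

Disjoint-⋃ : {p : Subset n} {qs : List (Subset n)} → All (Disjoint p) qs → Disjoint p (⋃ qs)
Disjoint-⋃ {p = p} {qs} p-qs-disjoint (x , x∈p∩⋃qs) =
  let x∈p , x∈⋃qs = x∈p∩q⁻ p (⋃ qs) x∈p∩⋃qs
      p∩q-empty , x∈q = All.lookupAny p-qs-disjoint (x∈⋃⁻ qs x∈⋃qs)
  in p∩q-empty (x , x∈p∩q⁺ (x∈p , x∈q))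

∣⋃∣≡sum : {ps : List (Subset n)} → AllPairs Disjoint ps → ∣ ⋃ ps ∣ ≡ sum (map ∣_∣ ps)
∣⋃∣≡sum {n} [] = ∣⊥∣≡0 n
∣⋃∣≡sum {ps = p ∷ ps} (p-ps-disjoint ∷ ps-disjoint) =
  trans (Disjoint⇒∣p∪q∣≡∣p∣+∣q∣ p (⋃ ps) (Disjoint-⋃ p-ps-disjoint))
        (cong (∣ p ∣ +_) (∣⋃∣≡sum ps-disjoint))

subsetOf : {P : Pred (Fin n) 0ℓ} → Decidable P → Subset n
subsetOf P? = tabulate (isYes ∘ P?)

module _ {P : Pred (Fin n) 0ℓ} (P? : Decidable P) where

  ∈subsetOf⁺ : P x → x ∈ subsetOf P?
  ∈subsetOf⁺ {x} px = lookup⇒[]= x _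
    (trans (lookup∘tabulate (isYes ∘ P?) x) (to T-≡ (fromWitness {a? = P? x} px)))

  ∈subsetOf⁻ : x ∈ subsetOf P? → P x
  ∈subsetOf⁻ {x} x∈ = toWitness {a? = P? x}
    (from T-≡ (trans (≡.sym (lookup∘tabulate (isYes ∘ P?) x)) ([]=⇒lookup x∈)))

¬¬-decidable : (P : Pred (Fin n) 0ℓ) → ¬ ¬ Decidable P
¬¬-decidable P = sequence (RawMonad.rawApplicative ¬¬-Monad) (λ _ → ¬¬-excluded-middle)

module _ (G : Graph n) where

  reachable-isComponent : (conn? : Decidable (Connected G x)) → IsComponent G (subsetOf conn?)
  reachable-isComponent {x} conn? = (x , ∈subsetOf⁺ conn? ε) , λ y z y∈ →
    mk⇔ (λ z∈ → Star.reverse (Graph.sym G) (∈subsetOf⁻ conn? y∈) ◅◅ ∈subsetOf⁻ conn? z∈)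
        (λ y~z → ∈subsetOf⁺ conn? (∈subsetOf⁻ conn? y∈ ◅◅ y~z))

  -- Adj is an arbitrary relation, so connectivity is not decidable and the component of x exists
  -- as a Subset only under double negation; the goals it is used for are decidable.
  cluster-connected⇒¬¬adjacent : IsClusterGraph G → Connected G x y → x ≢ y → ¬ ¬ Adj G x y
  cluster-connected⇒¬¬adjacent {x} {y} G-cluster x~y x≢y ¬adj =
    ¬¬-decidable (Connected G x) λ conn? →
      ¬adj (G-cluster _ (reachable-isComponent conn?) x y
                      (∈subsetOf⁺ conn? ε) (∈subsetOf⁺ conn? x~y) x≢y)

  component-⊆ : {S T : Subset n} → IsComponent G S → IsComponent G T → x ∈ S → x ∈ T → S ⊆ T
  component-⊆ {x} (_ , S-conn) (_ , T-conn) x∈S x∈T y∈S =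
    from (T-conn x _ x∈T) (to (S-conn x _ x∈S) y∈S)

  distinctComponents-disjoint : {S T : Subset n} →
                                IsComponent G S → IsComponent G T → S ≢ T → Disjoint S T
  distinctComponents-disjoint {S} {T} S-comp T-comp S≢T (x , x∈S∩T) =
    let x∈S , x∈T = x∈p∩q⁻ S T x∈S∩T
    in S≢T (⊆-antisym (component-⊆ S-comp T-comp x∈S x∈T) (component-⊆ T-comp S-comp x∈T x∈S))

  components-pairwiseDisjoint : {Hs : List (Subset n)} →
                                All (IsComponent G) Hs → Unique Hs → AllPairs Disjoint Hs
  components-pairwiseDisjoint All.[]                []               = []
  components-pairwiseDisjoint (H-comp All.∷ Hs-comp) (H∉Hs ∷ Hs-unique) =
    All.zipWith (λ (H′-comp , H≢H′) → distinctComponents-disjoint H-comp H′-comp H≢H′) (Hs-comp , H∉Hs)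
    ∷ components-pairwiseDisjoint Hs-comp Hs-unique

Joined : PairSet n → Fin n → Fin n → Set
Joined F v w = (v , w) List.∈ F ⊎ (w , v) List.∈ F

joined? : (F : PairSet n) (v w : Fin n) → Dec (Joined F v w)
joined? F v w = (v , w) ∈? F ⊎-dec (w , v) ∈? F
  where open DecMembership (≡-dec _≟_ _≟_) using (_∈?_)

ModifiesVertex⇒Joined : {F : PairSet n} → ModifiesVertex F x → ∃[ y ] Joined F x y
ModifiesVertex⇒Joined ((_ , b) , ab∈F , inj₁ refl) = b , inj₁ ab∈F
ModifiesVertex⇒Joined ((a , _) , ab∈F , inj₂ refl) = a , inj₂ ab∈F

Joined⇒≢ : {F : PairSet n} → ValidPairSet F → Joined F x y → x ≢ y
Joined⇒≢ (F-ordered , _) (inj₁ xy∈F) refl = <-irrefl refl (All.lookup F-ordered xy∈F)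
Joined⇒≢ (F-ordered , _) (inj₂ yx∈F) refl = <-irrefl refl (All.lookup F-ordered yx∈F)

Joined⇒¬Adj : {G : Graph n} {F : PairSet n} → NonEdges G F → Joined F x y → ¬ Adj G x y
Joined⇒¬Adj F-nonEdges (inj₁ xy∈F) = All.lookup F-nonEdges xy∈F
Joined⇒¬Adj {G = G} F-nonEdges (inj₂ yx∈F) = All.lookup F-nonEdges yx∈F ∘ Graph.sym G

endpoints : Fin n × Fin n → Subset n
endpoints (a , b) = ⁅ a ⁆ ∪ ⁅ b ⁆

vertices : PairSet n → Subset n
vertices F = ⋃ (map endpoints F)

∣vertices∣≤2*length : (F : PairSet n) → ∣ vertices F ∣ ≤ 2 * length F
∣vertices∣≤2*length F =
  ≤-trans (∣⋃map∣≤length* endpoints ∣endpoints∣≤2 F) (≤-reflexive (*-comm (length F) 2))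
  where
  ∣endpoints∣≤2 : ∀ ab → ∣ endpoints ab ∣ ≤ 2
  ∣endpoints∣≤2 (a , b) =
    ≤-trans (∣p∪q∣≤∣p∣+∣q∣ ⁅ a ⁆ ⁅ b ⁆) (≤-reflexive (cong₂ _+_ (∣⁅x⁆∣≡1 a) (∣⁅x⁆∣≡1 b)))

Joined⇒∈vertices : {F : PairSet n} → Joined F x y → x ∈ vertices F
Joined⇒∈vertices {x = x} (inj₁ xy∈F) =
  x∈⋃⁺ (map⁺ (Any.map (λ { refl → x∈p∪q⁺ (inj₁ (x∈⁅x⁆ x)) }) xy∈F))
Joined⇒∈vertices {x = x} (inj₂ yx∈F) =
  x∈⋃⁺ (map⁺ (Any.map (λ { refl → x∈p∪q⁺ (inj₂ (x∈⁅x⁆ x)) }) yx∈F))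

otherEnd : Fin n → Fin n × Fin n → Fin n
otherEnd w (a , b) = if does (a ≟ w) then b else a

otherEnd-≢ : {a w : Fin n} (b : Fin n) → a ≢ w → otherEnd w (a , b) ≡ a
otherEnd-≢ {a = a} {w} b a≢w with a ≟ w
... | yes a≡w = contradiction a≡w a≢w
... | no _    = refl

otherEnd-≡ : (w b : Fin n) → otherEnd w (w , b) ≡ b
otherEnd-≡ w b with w ≟ w
... | yes _   = refl
... | no w≢w = contradiction refl w≢w

neighbours : PairSet n → Fin n → Subset n
neighbours F w = ⋃ (map (⁅_⁆ ∘ otherEnd w) F)

∣neighbours∣≤length : (F : PairSet n) (w : Fin n) → ∣ neighbours F w ∣ ≤ length F
∣neighbours∣≤length F w =
  ≤-trans (∣⋃map∣≤length* (⁅_⁆ ∘ otherEnd w) (≤-reflexive ∘ ∣⁅x⁆∣≡1 ∘ otherEnd w) F)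
          (≤-reflexive (*-identityʳ (length F)))

Joined⇒∈neighbours : {F : PairSet n} {v w : Fin n} → Joined F v w → v ≢ w → v ∈ neighbours F w
Joined⇒∈neighbours {v = v} {w} (inj₁ vw∈F) v≢w = x∈⋃⁺ (map⁺ (Any.map
  (λ { refl → subst (λ u → v ∈ ⁅ u ⁆) (≡.sym (otherEnd-≢ w v≢w)) (x∈⁅x⁆ v) }) vw∈F))
Joined⇒∈neighbours {v = v} {w} (inj₂ wv∈F) _ = x∈⋃⁺ (map⁺ (Any.map
  (λ { refl → subst (λ u → v ∈ ⁅ u ⁆) (≡.sym (otherEnd-≡ w v)) (x∈⁅x⁆ v) }) wv∈F))

module ClusterCompletion (G : Graph n) (F : PairSet n)
         (G-cluster : IsClusterGraph G) (G+F-cluster : IsClusterGraph (G +E F))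
         (F-valid : ValidPairSet F) (F-nonEdges : NonEdges G F) where

  joinedComponent⇒hub : {H : Subset n} {v₀ w : Fin n} → IsComponent G H → v₀ ∈ H → Joined F v₀ w →
                        w ∉ H × (∀ {v} → v ∈ H → Joined F v w)
  joinedComponent⇒hub {H} {v₀} {w} H-comp@(_ , H-conn) v₀∈H v₀w = w∉H , v-joined
    where
    w∉H : w ∉ H
    w∉H w∈H = Joined⇒¬Adj {G = G} F-nonEdges v₀w
                (G-cluster H H-comp v₀ w v₀∈H w∈H (Joined⇒≢ F-valid v₀w))

    v-joined : ∀ {v} → v ∈ H → Joined F v w
    v-joined {v} v∈H = decidable-stable (joined? F v w) λ ¬vw →
      cluster-connected⇒¬¬adjacent (G +E F) G+F-cluster v~w v≢w
        λ { (inj₁ v-w) → w∉H (from (H-conn v w v∈H) (v-w ◅ ε))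
          ; (inj₂ (_ , vw)) → ¬vw vw }
      where
      v≢w : v ≢ w
      v≢w refl = w∉H v∈H
      v~w : Connected (G +E F) v w
      v~w = Star.map inj₁ (to (H-conn v v₀ v∈H) v₀∈H) ◅◅ (inj₂ (Joined⇒≢ F-valid v₀w , v₀w) ◅ ε)

  modifiedComponent⇒hub : {H : Subset n} → IsComponent G H → ModifiesComponent F H →
                          ∃[ w ] w ∉ H × (∀ {v} → v ∈ H → Joined F v w)
  modifiedComponent⇒hub H-comp (v₀ , v₀∈H , v₀-modified) =
    let w , v₀w = ModifiesVertex⇒Joined v₀-modified
    in w , joinedComponent⇒hub H-comp v₀∈H v₀w

  modifiedComponent⊆vertices : {H : Subset n} →
                               IsComponent G H → ModifiesComponent F H → H ⊆ vertices F
  modifiedComponent⊆vertices H-comp H-modified v∈H =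
    let _ , _ , H-joined = modifiedComponent⇒hub H-comp H-modified
    in Joined⇒∈vertices (H-joined v∈H)

mainTheorem18 : ∀ {n} (G : Graph n) (k η : ℕ) (F : PairSet n) →
    IsClusterGraph G →
    ValidPairSet F →
    NonEdges G F →
    length F ≤ k →
    IsClusterGraph (G +E F) →
    IsBalanced η (G +E F) →
    (∀ H → IsComponent G H → ModifiesComponent F H → ∣ H ∣ ≤ k)
    × (∀ (Hs : List (Subset n)) → Unique Hs →
         All (λ H → IsComponent G H × ModifiesComponent F H) Hs →
         sum (map ∣_∣ Hs) ≤ 2 * k)
mainTheorem18 G k _ F G-cluster F-valid F-nonEdges ∣F∣≤k G+F-cluster _ = componentBound , totalBound
  where
  open ≤-Reasoning
  open ClusterCompletion G F G-cluster G+F-cluster F-valid F-nonEdges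

  componentBound : ∀ H → IsComponent G H → ModifiesComponent F H → ∣ H ∣ ≤ k
  componentBound H H-comp H-modified =
    let w , w∉H , H-joined = modifiedComponent⇒hub H-comp H-modified
    in begin
      ∣ H ∣              ≤⟨ p⊆q⇒∣p∣≤∣q∣ (λ v∈H → Joined⇒∈neighbours (H-joined v∈H) (λ { refl → w∉H v∈H })) ⟩
      ∣ neighbours F w ∣ ≤⟨ ∣neighbours∣≤length F w ⟩
      length F           ≤⟨ ∣F∣≤k ⟩
      k                  ∎

  totalBound : ∀ Hs → Unique Hs → All (λ H → IsComponent G H × ModifiesComponent F H) Hs →
               sum (map ∣_∣ Hs) ≤ 2 * k
  totalBound Hs Hs-unique Hs-modified = begin
    sum (map ∣_∣ Hs) ≡⟨ ∣⋃∣≡sum (components-pairwiseDisjoint G (All.map proj₁ Hs-modified) Hs-unique) ⟨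
    ∣ ⋃ Hs ∣         ≤⟨ p⊆q⇒∣p∣≤∣q∣ ⋃Hs⊆vertices ⟩
    ∣ vertices F ∣   ≤⟨ ∣vertices∣≤2*length F ⟩
    2 * length F     ≤⟨ *-monoʳ-≤ 2 ∣F∣≤k ⟩
    2 * k            ∎
    where
    ⋃Hs⊆vertices : ⋃ Hs ⊆ vertices F
    ⋃Hs⊆vertices v∈⋃Hs =
      let (H-comp , H-modified) , v∈H = All.lookupAny Hs-modified (x∈⋃⁻ Hs v∈⋃Hs)
      in modifiedComponent⊆vertices H-comp H-modified v∈H
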